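{- Let $n\ge 1$ and let $\mathcal F$ be an $\mathcal N$-saturated family of subsets of $[n]$. Then $|\mathcal F|\ge\sqrt n$.
   Context: Subsets of $[n]=\{1,\dots,n\}$ are ordered by inclusion. For finite posets $\mathcal P$ and $\mathcal Q$, $\mathcal P$ contains an induced copy of $\mathcal Q$ if there is an injective map $f:\mathcal Q\to\mathcal P$ such that for all $a,b\in\mathcal Q$, $a\le b$ if and only if $f(a)\le f(b)$. A family $\mathcal F$ of subsets of $[n]$ is $\mathcal Q$-saturated if $\mathcal F$ contains no induced copy of $\mathcal Q$, but for every $S\subseteq[n]$ with $S\notin\mathcal F$, $\mathcal F\cup\{S\}$ contains an induced copy of $\mathcal Q$. The poset $\mathcal N$ is the four-element poset $\{a,b,c,d\}$ whose only strict relations are $a<b$, $c<b$, $c<d$ (so $a\parallel c$, $b\parallel d$, $a\parallel d$). -}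

module Defs where

open import Data.Nat using (ℕ)
open import Data.Fin using (Fin; zero; suc)
open import Data.Fin.Subset using (Subset; _⊆_)
open import Data.List using (List; _∷_)
open import Data.List.Membership.Propositional using (_∈_; _∉_)
open import Data.Product using (Σ; _×_)
open import Relation.Binary.PropositionalEquality using (_≡_)
open import Relation.Nullary using (¬_)
open import Level using (0ℓ)

-- A family of subsets of [n] is a list of subsets (duplicate-freeness is
-- imposed separately in the statement); a subset of [n] is Subset n.

-- Strict relations of the poset N on {a,b,c,d} = {0,1,2,3}:
-- a < b, c < b, c < d.
data N< : Fin 4 → Fin 4 → Set where
  a<b : N< zero (suc zero)
  c<b : N< (suc (suc zero)) (suc zero)
  c<d : N< (suc (suc zero)) (suc (suc (suc zero)))

data N≤ : Fin 4 → Fin 4 → Set where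
  N-refl : ∀ {x} → N≤ x x
  N-lt   : ∀ {x y} → N< x y → N≤ x y

InducedCopy : ∀ {n} (k : ℕ) (_≤Q_ : Fin k → Fin k → Set) → List (Subset n) → Set
InducedCopy {n} k _≤Q_ F =
  Σ (Fin k → Subset n) λ f →
    (∀ x → f x ∈ F) ×
    (∀ x y → f x ≡ f y → x ≡ y) ×
    (∀ x y → (x ≤Q y → f x ⊆ f y) × (f x ⊆ f y → x ≤Q y))

ContainsN : ∀ {n} → List (Subset n) → Set
ContainsN F = InducedCopy 4 N≤ F

NSaturated : ∀ {n} → List (Subset n) → Set
NSaturated {n} F = ¬ ContainsN F × (∀ (S : Subset n) → S ∉ F → ContainsN (S ∷ F))

-- A saturated family F contains [n], because N has no maximum. Call R ∈ F a
-- twin of S ⊂ R when every other member of F is comparable to S exactly as it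
-- is to R. Swapping S for R turns an induced copy of N in S ∷ F into one in F,
-- since no two elements of N are twins; so saturation forces S ∈ F. Now fix
-- i and descend from [n] through members D ∋ i of F. Either some Y ∈ F with
-- i ∉ Y contains D - i, or some X ∈ F with i ∈ X lies strictly below D, or
-- else D is a twin of D - i, whence D - i ∈ F is such a Y. So every i is
-- separated by a pair (X , Y) ∈ F × F with i ∈ X, i ∉ Y and X - i ⊆ Y, and the
-- pair determines i (every other element of X lies in Y); hence n ≤ |F|².
module Submission where

open import Defs
open import Data.Nat using (ℕ; _≤_; _*_)
open import Data.Fin.Subset using (Subset)
open import Data.List using (List; length)
open import Data.List.Relation.Unary.Unique.Propositional using (Unique)

open import Data.Bool.Properties using () renaming (_≟_ to _≟ᵇ_)
open import Data.Empty using (⊥-elim)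
open import Data.Fin using (Fin; zero; suc; combine; _≟_)
open import Data.Fin.Properties using (any?; combine-injective; injective⇒≤)
open import Data.Fin.Subset using (_⊆_; _⊂_; _-_; ⊤)
  renaming (_∈_ to _∈ˢ_; _∉_ to _∉ˢ_)
open import Data.Fin.Subset.Induction using (⊂-wellFounded)
open import Data.Fin.Subset.Properties
  using (_⊆?_; _⊂?_; ⊆-refl; ⊆-reflexive; ⊆-trans; ⊆-antisym; ⊆⊤; ∈⊤; p─q⊆p;
         x∈p∧x≢y⇒x∈p-y; x∈p⇒p-x⊂p)
  renaming (_∈?_ to _∈ˢ?_)
open import Data.List using (_∷_)
open import Data.List.Membership.Propositional using (_∈_; _∉_; find; lose)
open import Data.List.Membership.Setoid.Properties using (index-injective)
open import Data.List.Relation.Unary.Any as Any using (index)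
open import Data.Product using (∃; _×_; _,_; proj₁; proj₂)
open import Data.Sum using (_⊎_; inj₁; inj₂)
open import Data.Vec using (_∷_)
open import Data.Vec.Base using (there)
open import Data.Vec.Properties using (≡-dec)
open import Function using (_∘_)
open import Function.Bundles using (_⇔_; mk⇔; Equivalence)
open import Function.Construct.Identity using (⇔-id)
open import Induction.WellFounded using (Acc; acc)
open import Relation.Binary.PropositionalEquality using (_≡_; _≢_; refl; sym; subst; subst₂; setoid)
open import Relation.Nullary using (¬_; Dec; yes; no; contradiction)
open import Relation.Nullary.Decidable using (_×-dec_; ¬?; decidable-stable)

private
  variable
    n : ℕ
    i j : Fin n
    p q S R : Subset n
    F : List (Subset n)

_≟ˢ_ : (p q : Subset n) → Dec (p ≡ q)
_≟ˢ_ = ≡-dec _≟ᵇ_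


x∉p-x : (p : Subset n) (x : Fin n) → x ∉ˢ p - x
x∉p-x (_ ∷ p) zero    ()
x∉p-x (_ ∷ p) (suc x) (there x∈p-x) = x∉p-x p x x∈p-x

p-x⊆p : (p : Subset n) (x : Fin n) → p - x ⊆ p
p-x⊆p p x = p─q⊆p p _

p⊆q∧x∉p⇒p⊆q-x : p ⊆ q → i ∉ˢ p → p ⊆ q - i
p⊆q∧x∉p⇒p⊆q-x p⊆q i∉p j∈p = x∈p∧x≢y⇒x∈p-y (p⊆q j∈p) λ { refl → i∉p j∈p }

p-x⊆q∧x∈q⇒p⊆q : p - i ⊆ q → i ∈ˢ q → p ⊆ q
p-x⊆q∧x∈q⇒p⊆q {i = i} p-i⊆q i∈q {j} j∈p with j ≟ i
... | yes refl = i∈q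
... | no  j≢i  = p-i⊆q (x∈p∧x≢y⇒x∈p-y j∈p j≢i)

p⊆q∧p≢q⇒p⊂q : p ⊆ q → p ≢ q → p ⊂ q
p⊆q∧p≢q⇒p⊂q {p = p} {q = q} p⊆q p≢q with any? (λ j → (j ∈ˢ? q) ×-dec ¬? (j ∈ˢ? p))
... | yes (j , j∈q , j∉p) = p⊆q , j , j∈q , j∉p
... | no  ∄j = contradiction (⊆-antisym p⊆q q⊆p) p≢q
  where
  q⊆p : q ⊆ p
  q⊆p {j} j∈q = decidable-stable (j ∈ˢ? p) λ j∉p → ∄j (j , j∈q , j∉p)

-- mk⇔ cannot infer carriers that are implicit Π-types such as p ⊆ q.
⊆⇔ : ∀ {p q p′ q′ : Subset n} → (p ⊆ q → p′ ⊆ q′) → (p′ ⊆ q′ → p ⊆ q) → p ⊆ q ⇔ p′ ⊆ q′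
⊆⇔ = mk⇔

module _ {k : ℕ} (_≼_ : Fin k → Fin k → Set) where

  HasNoMaximum : Set
  HasNoMaximum = ∀ x → ∃ λ y → ¬ y ≼ x

  Twins : Fin k → Fin k → Set
  Twins x y = ∀ z → z ≢ x → z ≢ y → (z ≼ y → z ≼ x) × (x ≼ z → y ≼ z)

  TwinFree : Set
  TwinFree = ∀ {x y} → x ≼ y → ¬ y ≼ x → ¬ Twins x y

  Saturated : List (Subset n) → Set
  Saturated F = ¬ InducedCopy k _≼_ F × (∀ S → S ∉ F → InducedCopy k _≼_ (S ∷ F))

TwinIn : List (Subset n) → Subset n → Subset n → Set
TwinIn F R S = ∀ X → X ∈ F → X ≢ R → (X ⊆ R ⇔ X ⊆ S) × (R ⊆ X ⇔ S ⊆ X)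

module Replacement {n : ℕ} {F : List (Subset n)} {S R : Subset n}
                   (R∈F : R ∈ F) (R-twin : TwinIn F R S) where

  replace : Subset n → Subset n
  replace X with X ≟ˢ S
  ... | yes _ = R
  ... | no  _ = X

  replace-∈ : ∀ {X} → X ∈ S ∷ F → replace X ∈ F
  replace-∈ {X = X} X∈S∷F with X ≟ˢ S
  ... | yes _   = R∈F
  ... | no  X≢S = Any.tail X≢S X∈S∷F

  replace-⊆⇔ : ∀ {X Y} → X ∈ S ∷ F → Y ∈ S ∷ F → (X ≡ S → Y ≢ R) → (Y ≡ S → X ≢ R) →
               replace X ⊆ replace Y ⇔ X ⊆ Y
  replace-⊆⇔ {X = X} {Y = Y} X∈S∷F Y∈S∷F X≡S⇒Y≢R Y≡S⇒X≢R with X ≟ˢ S | Y ≟ˢ S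
  ... | yes refl | yes refl = ⊆⇔ (λ _ → ⊆-refl) (λ _ → ⊆-refl)
  ... | yes refl | no  Y≢S = proj₂ (R-twin Y (Any.tail Y≢S Y∈S∷F) (X≡S⇒Y≢R refl))
  ... | no  X≢S  | yes refl = proj₁ (R-twin X (Any.tail X≢S X∈S∷F) (Y≡S⇒X≢R refl))
  ... | no  _    | no  _    = ⇔-id _

module _ {k : ℕ} {_≼_ : Fin k → Fin k → Set} where

  copy-avoiding : (c : InducedCopy k _≼_ (S ∷ F)) → (∀ x → proj₁ c x ≢ S) → InducedCopy k _≼_ F
  copy-avoiding (f , f∈ , f-inj , f-emb) f≢S = f , (λ x → Any.tail (f≢S x) (f∈ x)) , f-inj , f-emb

  copy-transfer : TwinFree _≼_ → R ∈ F → TwinIn F R S → S ⊂ R →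
                  InducedCopy k _≼_ (S ∷ F) → InducedCopy k _≼_ F
  copy-transfer {R = R} {F = F} {S = S} twinFree R∈F R-twin (S⊆R , _ , j∈R , j∉S)
                (f , f∈ , f-inj , f-emb) =
    replace ∘ f , replace-∈ ∘ f∈ , g-inj , λ x y →
      from (⊆-preserved x y) ∘ proj₁ (f-emb x y) , proj₂ (f-emb x y) ∘ to (⊆-preserved x y)
    where
    open Replacement R∈F R-twin
    open Equivalence using (to; from)

    apart : ∀ {x y} → f x ≡ S → f y ≢ R
    apart {x} {y} refl refl = twinFree x≼y y⋠x twins
      where
      x≼y : x ≼ y
      x≼y = proj₂ (f-emb x y) S⊆R
      y⋠x : ¬ y ≼ x
      y⋠x y≼x = j∉S (proj₁ (f-emb y x) y≼x j∈R)
      twins : Twins _≼_ x y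
      twins z z≢x z≢y =
          (λ z≼y → proj₂ (f-emb z x) (to below (proj₁ (f-emb z y) z≼y)))
        , (λ x≼z → proj₂ (f-emb y z) (from above (proj₁ (f-emb x z) x≼z)))
        where
        fz≢fx : f z ≢ f x
        fz≢fx = z≢x ∘ f-inj z x
        fz≢fy : f z ≢ f y
        fz≢fy = z≢y ∘ f-inj z y
        below = proj₁ (R-twin (f z) (Any.tail fz≢fx (f∈ z)) fz≢fy)
        above = proj₂ (R-twin (f z) (Any.tail fz≢fx (f∈ z)) fz≢fy)

    ⊆-preserved : ∀ x y → replace (f x) ⊆ replace (f y) ⇔ f x ⊆ f y
    ⊆-preserved x y = replace-⊆⇔ (f∈ x) (f∈ y) apart apart

    g-inj : ∀ x y → replace (f x) ≡ replace (f y) → x ≡ y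
    g-inj x y eq = f-inj x y (⊆-antisym (to (⊆-preserved x y) (⊆-reflexive eq))
                                        (to (⊆-preserved y x) (⊆-reflexive (sym eq))))

Separates : Fin n → Subset n → Subset n → Set
Separates i X Y = i ∈ˢ X × i ∉ˢ Y × X - i ⊆ Y

separates-injective : ∀ {X Y} → Separates i X Y → Separates j X Y → i ≡ j
separates-injective {i = i} {j = j} (i∈X , i∉Y , _) (_ , _ , X-j⊆Y) =
  decidable-stable (i ≟ j) λ i≢j → i∉Y (X-j⊆Y (x∈p∧x≢y⇒x∈p-y i∈X i≢j))

record SeparatingPair (F : List (Subset n)) (i : Fin n) : Set where
  constructor separatingPair
  field
    {X Y}     : Subset n
    X∈F       : X ∈ F
    Y∈F       : Y ∈ F
    separates : Separates i X Y

separated⇒n≤|F|² : (F : List (Subset n)) → (∀ i → SeparatingPair F i) → n ≤ length F * length F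
separated⇒n≤|F|² F sep = injective⇒≤ code-injective
  where
  open SeparatingPair

  code : Fin _ → Fin (length F * length F)
  code i = combine (index (X∈F (sep i))) (index (Y∈F (sep i)))

  code-injective : ∀ {i j} → code i ≡ code j → i ≡ j
  code-injective {i} {j} eq =
    separates-injective (separates (sep i))
                        (subst₂ (Separates j) (sym Xᵢ≡Xⱼ) (sym Yᵢ≡Yⱼ) (separates (sep j)))
    where
    indices≡ = combine-injective _ _ _ _ eq
    Xᵢ≡Xⱼ = index-injective (setoid _) (X∈F (sep i)) (X∈F (sep j)) (proj₁ indices≡)
    Yᵢ≡Yⱼ = index-injective (setoid _) (Y∈F (sep i)) (Y∈F (sep j)) (proj₂ indices≡)

module Saturation {k : ℕ} {_≼_ : Fin k → Fin k → Set} {n : ℕ} {F : List (Subset n)}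
                  (sat : Saturated _≼_ F) where

  open import Data.List.Membership.DecPropositional (_≟ˢ_ {n}) using (_∈?_)

  ⊤∈F : HasNoMaximum _≼_ → ⊤ ∈ F
  ⊤∈F noMaximum = decidable-stable (⊤ ∈? F) (no-copy-through-⊤ ∘ proj₂ sat ⊤)
    where
    no-copy-through-⊤ : ¬ InducedCopy k _≼_ (⊤ ∷ F)
    no-copy-through-⊤ c@(f , _ , _ , f-emb) with any? (λ x → f x ≟ˢ ⊤)
    ... | yes (x , fx≡⊤) = let (y , y⋠x) = noMaximum x in
                           y⋠x (proj₂ (f-emb y x) (subst (f y ⊆_) (sym fx≡⊤) ⊆⊤))
    ... | no  ∄x         = proj₁ sat (copy-avoiding c λ x fx≡⊤ → ∄x (x , fx≡⊤))

  twin∈F : TwinFree _≼_ → R ∈ F → TwinIn F R S → S ⊂ R → S ∈ F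
  twin∈F twinFree R∈F R-twin S⊂R =
    decidable-stable (_ ∈? F) (proj₁ sat ∘ copy-transfer twinFree R∈F R-twin S⊂R ∘ proj₂ sat _)

  module _ (twinFree : TwinFree _≼_) where

    separate-or-shrink : ∀ {i D} → D ∈ F → i ∈ˢ D →
                         (∃ λ Y → Y ∈ F × i ∉ˢ Y × D - i ⊆ Y) ⊎ (∃ λ X → X ∈ F × i ∈ˢ X × X ⊂ D)
    separate-or-shrink {i} {D} D∈F i∈D with Any.any? (λ Y → ¬? (i ∈ˢ? Y) ×-dec (D - i ⊆? Y)) F
    ... | yes separating = inj₁ (find separating)
    ... | no  ∄separating with Any.any? (λ X → (i ∈ˢ? X) ×-dec (X ⊂? D)) F
    ...   | yes shrinking = inj₂ (find shrinking)
    ...   | no  ∄shrinking =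
            ⊥-elim (∄separating (lose (twin∈F twinFree D∈F D-twin (x∈p⇒p-x⊂p i∈D))
                                      (x∉p-x D i , ⊆-refl)))
      where
      D-twin : TwinIn F D (D - i)
      D-twin X X∈F X≢D with i ∈ˢ? X
      ... | yes i∈X = ⊆⇔ (λ X⊆D → ⊥-elim (∄shrinking (lose X∈F (i∈X , p⊆q∧p≢q⇒p⊂q X⊆D X≢D))))
                         (λ X⊆D-i → ⊆-trans X⊆D-i (p-x⊆p D i))
                    , ⊆⇔ (λ D⊆X → ⊆-trans (p-x⊆p D i) D⊆X)
                         (λ D-i⊆X → p-x⊆q∧x∈q⇒p⊆q D-i⊆X i∈X)
      ... | no  i∉X = ⊆⇔ (λ X⊆D → p⊆q∧x∉p⇒p⊆q-x X⊆D i∉X)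
                         (λ X⊆D-i → ⊆-trans X⊆D-i (p-x⊆p D i))
                    , ⊆⇔ (λ D⊆X → ⊆-trans (p-x⊆p D i) D⊆X)
                         (λ D-i⊆X → ⊥-elim (∄separating (lose X∈F (i∉X , D-i⊆X))))

    separatingPair-below : ∀ {i D} → Acc _⊂_ D → D ∈ F → i ∈ˢ D → SeparatingPair F i
    separatingPair-below (acc smaller) D∈F i∈D with separate-or-shrink D∈F i∈D
    ... | inj₁ (Y , Y∈F , i∉Y , D-i⊆Y) = separatingPair D∈F Y∈F (i∈D , i∉Y , D-i⊆Y)
    ... | inj₂ (X , X∈F , i∈X , X⊂D)   = separatingPair-below (smaller X⊂D) X∈F i∈X

    every-element-separated : HasNoMaximum _≼_ → ∀ i → SeparatingPair F i
    every-element-separated noMaximum i = separatingPair-below (⊂-wellFounded ⊤) (⊤∈F noMaximum) ∈⊤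

private
  pattern a = zero
  pattern b = suc zero
  pattern c = suc (suc zero)
  pattern d = suc (suc (suc zero))

N-hasNoMaximum : HasNoMaximum N≤
N-hasNoMaximum a = c , λ { (N-lt ()) }
N-hasNoMaximum b = d , λ { (N-lt ()) }
N-hasNoMaximum c = a , λ { (N-lt ()) }
N-hasNoMaximum d = a , λ { (N-lt ()) }

N-twinFree : TwinFree N≤
N-twinFree N-refl      y⋠x _     = y⋠x N-refl
N-twinFree (N-lt a<b) _ twins with proj₁ (twins c (λ ()) (λ ())) (N-lt c<b)
... | N-lt ()
N-twinFree (N-lt c<b) _ twins with proj₁ (twins a (λ ()) (λ ())) (N-lt a<b)
... | N-lt ()
N-twinFree (N-lt c<d) _ twins with proj₂ (twins b (λ ()) (λ ())) (N-lt c<b)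
... | N-lt ()

proposition4 : (n : ℕ) → 1 ≤ n → (F : List (Subset n)) → Unique F → NSaturated F →
    n ≤ length F * length F
proposition4 n _ F _ saturated =
  separated⇒n≤|F|² F (Saturation.every-element-separated saturated N-twinFree N-hasNoMaximum)
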